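{- Let $G=(X,Y,E)$, $\mathcal{P}_X$, $\mathcal{P}_Y$ be an instance of MIN-REP and let $G'$ be the graph constructed from it as described in the context, with hub set $H$ and dummy set $M$. Then only $H$ can cover the target couples of $G'$ in $[M,M]$: a set $D\subseteq V(G')$ covers every target couple of $G'$ with both vertices in $M$ if and only if $H\subseteq D$.
   Context: MIN-REP instance: a bipartite graph $G=(X,Y,E)$, a partition $\mathcal{P}_X=\{X_1,\dots,X_{k_X}\}$ of $X$ into sets of size $|X|/k_X$, and a partition $\mathcal{P}_Y=\{Y_1,\dots,Y_{k_Y}\}$ of $Y$ into sets of size $|Y|/k_Y$. $X_i$ and $Y_j$ form a super edge if some vertex of $X_i$ is adjacent in $G$ to some vertex of $Y_j$. Construction of $G'$: start with $G$. For each $X_i$ add two vertices $px^1_i,px^2_i$ and edges $(x,px^1_i),(x,px^2_i)$ for every $x\in X_i$; for each $Y_j$ add two vertices $py^1_j,py^2_j$ and edges $(y,py^1_j),(y,py^2_j)$ for every $y\in Y_j$. For each super edge $(X_i,Y_j)$ add two vertices (relays) $r^1_{i,j},r^2_{i,j}$ and edges $(px^1_i,r^1_{i,j}),(r^1_{i,j},py^1_j),(px^2_i,r^2_{i,j}),(r^2_{i,j},py^2_j)$. Let $PX$ be the set of all $px^I_i$, $PY$ the set of all $py^I_j$, $R$ the set of relays. Add four hubs $h_{X,R},h_{Y,R},h_{PX},h_{PY}$ (the set $H$): $h_{X,R}$ is adjacent to every vertex of $X\cup R$, $h_{Y,R}$ to every vertex of $Y\cup R$, $h_{PX}$ to every vertex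 of $PX$, $h_{PY}$ to every vertex of $PY$, and the hubs form the 4-cycle $(h_{PX},h_{Y,R},h_{PY},h_{X,R},h_{PX})$. Finally, for each hub $h$ add two new vertices (dummy nodes) $d_1,d_2$ and edges $(h,d_1),(h,d_2)$; $M$ is the set of dummy nodes. Covering: for a graph $G'$ and vertices $u,v$, $m_{G'}(u,v)$ is the number of internal vertices on a shortest $u$–$v$ path ($\infty$ if none); for $D\subseteq V(G')$, $m^D(u,v)=m_{G'[D\cup\{u,v\}]}(u,v)$. Vertices $u,v$ form a target couple $[u,v]$ if $m_{G'}(u,v)=1$ (non-adjacent with a common neighbor). $D$ covers $[u,v]$ if $m^D(u,v)\le 2$. A target couple $[a,b]$ is in $[A,B]$ if $a\in A$ and $b\in B$. -}

module Defs where

open import Data.Nat using (ℕ; zero; suc; _*_; _≤_; _<_)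
open import Data.Fin using (Fin; _≟_)
open import Data.List using (List; length; filter; allFin)
open import Data.Product using (Σ; ∃; _×_; _,_)
open import Data.Sum using (_⊎_)
open import Relation.Binary.PropositionalEquality using (_≡_)
open import Relation.Nullary using (¬_)
open import Data.Unit using (⊤)

-- A MIN-REP instance: bipartite graph G = (X, Y, E) with X = Fin nX, Y = Fin nY,
-- partitions P_X, P_Y given by block-assignment maps pX, pY.
-- The block X_i is { x | pX x ≡ i }.
record MinRep : Set₁ where
  field
    nX nY kX kY : ℕ
    E  : Fin nX → Fin nY → Set
    pX : Fin nX → Fin kX
    pY : Fin nY → Fin kY

  sizeX : Fin kX → ℕ
  sizeX i = length (filter (λ x → pX x ≟ i) (allFin nX))

  sizeY : Fin kY → ℕ
  sizeY j = length (filter (λ y → pY y ≟ j) (allFin nY))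

  field
    nonemptyX : ∀ i → 0 < sizeX i
    nonemptyY : ∀ j → 0 < sizeY j
    sizesX : ∀ i → sizeX i * kX ≡ nX
    sizesY : ∀ j → sizeY j * kY ≡ nY

  SuperEdge : Fin kX → Fin kY → Set
  SuperEdge i j = Σ (Fin nX) λ x → Σ (Fin nY) λ y → pX x ≡ i × pY y ≡ j × E x y

data Hub : Set where
  hXR hYR hPX hPY : Hub

module Construction (I : MinRep) where
  open MinRep I

  -- Copies (superscript 1,2) are indexed by Fin 2.
  -- A relay r^t_{i,j} exists only for super edges (X_i, Y_j): the proof is
  -- an irrelevant argument, so each relay is a single vertex.
  data V : Set where
    vx  : Fin nX → V
    vy  : Fin nY → V
    vpx : Fin 2 → Fin kX → V
    vpy : Fin 2 → Fin kY → V
    vr  : Fin 2 → (i : Fin kX) (j : Fin kY) → .(SuperEdge i j) → V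
    vh  : Hub → V
    vm  : Hub → Fin 2 → V      -- dummy nodes d_1, d_2 of each hub

  -- The edges of G' (one orientation each)
  data Edge : V → V → Set where
    eG    : ∀ {x y} → E x y → Edge (vx x) (vy y)
    ePX   : ∀ {x t i} → pX x ≡ i → Edge (vx x) (vpx t i)
    ePY   : ∀ {y t j} → pY y ≡ j → Edge (vy y) (vpy t j)
    eR1   : ∀ {t i j} .{s : SuperEdge i j} → Edge (vpx t i) (vr t i j s)
    eR2   : ∀ {t i j} .{s : SuperEdge i j} → Edge (vr t i j s) (vpy t j)
    eXR-X : ∀ {x} → Edge (vh hXR) (vx x)
    eXR-R : ∀ {t i j} .{s : SuperEdge i j} → Edge (vh hXR) (vr t i j s)
    eYR-Y : ∀ {y} → Edge (vh hYR) (vy y)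
    eYR-R : ∀ {t i j} .{s : SuperEdge i j} → Edge (vh hYR) (vr t i j s)
    ePX-P : ∀ {t i} → Edge (vh hPX) (vpx t i)
    ePY-P : ∀ {t j} → Edge (vh hPY) (vpy t j)
    eC1   : Edge (vh hPX) (vh hYR)
    eC2   : Edge (vh hYR) (vh hPY)
    eC3   : Edge (vh hPY) (vh hXR)
    eC4   : Edge (vh hXR) (vh hPX)
    eM    : ∀ {h t} → Edge (vh h) (vm h t)

  Adj : V → V → Set
  Adj u v = Edge u v ⊎ Edge v u

  -- Reach S u v n : there is a u–v path in G' with exactly n internal
  -- vertices, all of which lie in S.
  data Reach (S : V → Set) : V → V → ℕ → Set where
    triv : ∀ {u} → Reach S u u 0
    edge : ∀ {u v} → Adj u v → Reach S u v 0
    step : ∀ {u w v n} → Adj u w → S w → Reach S w v n → Reach S u v (suc n)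

  _∪uv : (V → Set) → V → V → V → Set
  (D ∪uv) u v w = D w ⊎ w ≡ u ⊎ w ≡ v

  All : V → Set
  All _ = ⊤

  -- m_{G'[S]}(u,v) ≤ k : a shortest u–v path within S has ≤ k internal vertices
  mLe : (V → Set) → V → V → ℕ → Set
  mLe S u v k = ∃ λ n → n ≤ k × Reach S u v n

  TargetCouple : V → V → Set
  TargetCouple u v = mLe All u v 1 × ¬ mLe All u v 0

  Covers : (V → Set) → V → V → Set
  Covers D u v = mLe ((D ∪uv) u v) u v 2

  InM : V → Set
  InM w = ∃ λ h → ∃ λ t → w ≡ vm h t

  CoversMM : (V → Set) → Set
  CoversMM D = ∀ u v → InM u → InM v → TargetCouple u v → Covers D u v

  HubsIn : (V → Set) → Set
  HubsIn D = ∀ h → D (vh h)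

module Submission where

-- Every dummy node d of a hub h is a leaf of G' whose unique neighbour is h.
-- Hence (1) every path leaving d has h as its first internal vertex, and
-- (2) two dummies are never adjacent, so a target couple [d, d'] in [M, M]
-- is joined by a path d – h – d' with exactly one internal vertex.
--
-- If H ⊆ D, the path d – h – d' survives in G'[D ∪ {d, d'}], so D covers
-- [d, d'].  Conversely, the two dummies of a hub h form a target couple; a
-- covering path between them must have an internal vertex (they are not
-- adjacent), its first internal vertex is h by (1), and h is neither
-- endpoint, so h ∈ D.

open import Defs
open import Function.Bundles using (_⇔_; mk⇔)
open import Data.Nat using (zero; suc; z≤n; s≤s)
open import Data.Fin using (Fin)
open import Data.Product using (_,_)
open import Data.Sum using (inj₁; inj₂)
open import Data.Unit using (tt)
open import Data.Empty using (⊥; ⊥-elim)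
open import Relation.Binary.PropositionalEquality using (_≡_; refl)

module DummyNodes (I : MinRep) where
  open Construction I

  reach-zero : ∀ {S T : V → Set} {u v} → Reach S u v 0 → Reach T u v 0
  reach-zero triv     = triv
  reach-zero (edge a) = edge a

  target-length-one : ∀ {u v} → TargetCouple u v → Reach All u v 1
  target-length-one ((zero , _ , r) , not-short) = ⊥-elim (not-short (0 , z≤n , r))
  target-length-one ((suc zero , _ , r) , _)     = r
  target-length-one ((suc (suc _) , s≤s () , _) , _)

  leave-dummy-via-hub : ∀ {S h t v n} → Reach S (vm h t) v (suc n) → S (vh h)
  leave-dummy-via-hub (step (inj₁ ()) _ _)
  leave-dummy-via-hub (step (inj₂ eM) s _) = s

  dummies-not-adjacent : ∀ {S h t h' t'} →
    (vm h t ≡ vm h' t' → ⊥) → Reach S (vm h t) (vm h' t') 0 → ⊥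
  dummies-not-adjacent distinct triv = distinct refl
  dummies-not-adjacent _ (edge (inj₁ ()))
  dummies-not-adjacent _ (edge (inj₂ ()))

  d₁ d₂ : Hub → V
  d₁ h = vm h Fin.zero
  d₂ h = vm h (Fin.suc Fin.zero)

  d₁≢d₂ : ∀ {h} → d₁ h ≡ d₂ h → ⊥
  d₁≢d₂ ()

  twins-target : ∀ h → TargetCouple (d₁ h) (d₂ h)
  twins-target h =
    (1 , s≤s z≤n , step (inj₂ eM) tt (edge (inj₁ eM))) ,
    λ { (zero , _ , r) → dummies-not-adjacent d₁≢d₂ r
      ; (suc _ , () , _) }

  hub-covers : ∀ {D h t v} → D (vh h) → Reach All (vm h t) v 1 → Covers D (vm h t) v
  hub-covers _   (step (inj₁ ()) _ _)
  hub-covers hub (step (inj₂ eM) _ r) = 1 , s≤s z≤n , step (inj₂ eM) (inj₁ hub) (reach-zero r)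

  twins-covered-hub : ∀ {D} h → Covers D (d₁ h) (d₂ h) → D (vh h)
  twins-covered-hub h (zero , _ , r)    = ⊥-elim (dummies-not-adjacent d₁≢d₂ r)
  twins-covered-hub h (suc _ , _ , r) with leave-dummy-via-hub r
  ... | inj₁ in-D         = in-D
  ... | inj₂ (inj₁ ())
  ... | inj₂ (inj₂ ())

lemma4 : (I : MinRep) (D : Construction.V I → Set) →
    Construction.CoversMM I D ⇔ Construction.HubsIn I D
lemma4 I D = mk⇔ covers⇒hubs hubs⇒covers
  where
  open Construction I
  open DummyNodes I

  covers⇒hubs : CoversMM D → HubsIn D
  covers⇒hubs covers h =
    twins-covered-hub h (covers (d₁ h) (d₂ h) (h , _ , refl) (h , _ , refl) (twins-target h))

  hubs⇒covers : HubsIn D → CoversMM D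
  hubs⇒covers hubs .(vm h t) v (h , t , refl) _ target =
    hub-covers (hubs h) (target-length-one target)
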